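{- Let $T$ be a tree and let $\widehat{\bullet}$ be a coloring of the sibling graph $S(T)$. Define a coloring $\overline{\bullet}$ of the leaf graph $K(T)$ by $\overline{st}\equiv\widehat{uv}$ for distinct leaves $s,t$, where $u,v$ are the siblings with $s\leq u$ and $t\leq v$. Then this coloring satisfies $\overline{st}=\overline{rt}$ whenever $s$ and $r$ are leaves having a common ancestor that is unrelated to the leaf $t$. Conversely, every coloring of $K(T)$ with this property arises by this rule from some coloring of $S(T)$.
   Context: A tree is a finite poset $T$ in which every pair of unrelated elements has a common upper bound but no common lower bound. $t$ is the parent of $s$ (and $s$ a child of $t$) if $s<t$ and there is no $r$ with $s<r<t$; $t$ is an ancestor of $s$ if $s<t$. Two elements are siblings if they are unrelated and have the same parent; any two unrelated elements $s,t$ have unique siblings $u\ge s$, $v\ge t$. A leaf is an element with no children. The sibling graph $S(T)$ has vertex set $T$ and edges $st$ for all sibling pairs $s,t$; a coloring of $S(T)$ assigns a color $\widehat{st}$ to each such edge. The leaf graph $K(T)$ is the complete graph on the set of leaves of $T$. -}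

module Defs where

open import Data.Nat using (ℕ)
open import Data.Fin using (Fin)
open import Data.Product using (Σ; ∃; ∃-syntax; _×_; _,_)
open import Relation.Nullary using (¬_; Dec)
open import Relation.Binary.PropositionalEquality using (_≡_; _≢_)

record Tree (n : ℕ) : Set₁ where
  field
    _≤_      : Fin n → Fin n → Set
    ≤-dec    : ∀ s t → Dec (s ≤ t)
    ≤-refl   : ∀ s → s ≤ s
    ≤-antisym : ∀ {s t} → s ≤ t → t ≤ s → s ≡ t
    ≤-trans  : ∀ {r s t} → r ≤ s → s ≤ t → r ≤ t

  Unrelated : Fin n → Fin n → Set
  Unrelated s t = ¬ (s ≤ t) × ¬ (t ≤ s)

  field
    upper    : ∀ s t → Unrelated s t → ∃[ w ] (s ≤ w × t ≤ w)
    no-lower : ∀ s t → Unrelated s t → ¬ (∃[ w ] (w ≤ s × w ≤ t))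

  _<_ : Fin n → Fin n → Set
  s < t = s ≤ t × s ≢ t

  Parent : Fin n → Fin n → Set
  Parent t s = s < t × ¬ (∃[ r ] (s < r × r < t))

  Ancestor : Fin n → Fin n → Set
  Ancestor t s = s < t

  Siblings : Fin n → Fin n → Set
  Siblings s t = Unrelated s t × ∃[ p ] (Parent p s × Parent p t)

  Leaf : Fin n → Set
  Leaf s = ¬ (∃[ c ] Parent s c)

  -- A coloring of the sibling graph S(T): a color for each (unordered) edge,
  -- represented by a function symmetric on sibling pairs (other values irrelevant).
  IsSColoring : {C : Set} → (Fin n → Fin n → C) → Set
  IsSColoring c = ∀ s t → Siblings s t → c s t ≡ c t s

  IsKColoring : {C : Set} → (Fin n → Fin n → C) → Set
  IsKColoring κ = ∀ s t → Leaf s → Leaf t → s ≢ t → κ s t ≡ κ t s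

  Induced : {C : Set} → (Fin n → Fin n → C) → (Fin n → Fin n → C) → Set
  Induced c κ = ∀ s t → Leaf s → Leaf t → s ≢ t →
                ∀ u v → Siblings u v → s ≤ u → t ≤ v → κ s t ≡ c u v

  Property : {C : Set} → (Fin n → Fin n → C) → Set
  Property κ = ∀ s r t → Leaf s → Leaf r → Leaf t →
               (∃[ a ] (Ancestor a s × Ancestor a r × Unrelated a t)) →
               κ s t ≡ κ r t

-- Every element of a tree lies above a leaf, and every element strictly
-- below x lies below a child of x.  Hence two unrelated elements s, t lie
-- below siblings u, v (children of their least common upper bound), and
-- these are unique: if u < u' with u' ≥ s, then the parent of u is ≤ u',
-- so t is a common lower bound of the siblings u', v'.  This makes the
-- induced coloring well defined, and it has the property because leaves
-- below a common ancestor unrelated to t share the sibling above them.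
-- Conversely, given κ with the property, colour a sibling pair u v by κ at
-- leaves chosen below u and v; by the property the colour κ(st) does not
-- depend on which leaves below u and v are taken.
module Submission where

open import Defs
open import Level using (0ℓ)
open import Data.Nat using (ℕ)
open import Data.Fin using (Fin; _≟_)
open import Data.Fin.Properties using (any?)
open import Data.Fin.Induction using (po-wellFounded; po-noetherian)
open import Data.Product using (∃-syntax; _×_; _,_; proj₁; proj₂)
open import Data.Sum using (_⊎_; inj₁; inj₂)
open import Data.Empty using (⊥-elim)
open import Relation.Nullary using (¬_; yes; no; contradiction)
open import Relation.Nullary.Decidable using (_×-dec_; ¬?)
open import Relation.Unary using (Pred)
import Relation.Unary as U
open import Relation.Binary using (Rel; Decidable; IsPartialOrder)
open import Relation.Binary.PropositionalEquality
open import Induction.WellFounded using (WellFounded; Acc; acc)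
open import Function using (flip)

module _ {n : ℕ} {_⊏_ : Rel (Fin n) 0ℓ} {P : Pred (Fin n) 0ℓ}
         (_⊏?_ : Decidable _⊏_) (P? : U.Decidable P) where

  acc⇒minimal : ∀ {w} → Acc _⊏_ w → P w → ∃[ m ] (P m × ∀ {z} → P z → ¬ z ⊏ m)
  acc⇒minimal {w} (acc rs) pw with any? (λ z → P? z ×-dec z ⊏? w)
  ... | yes (z , pz , z⊏w) = acc⇒minimal (rs z⊏w) pz
  ... | no ∄ = w , pw , λ {z} pz z⊏w → ∄ (z , pz , z⊏w)

  wf⇒minimal : WellFounded _⊏_ → ∀ {w} → P w → ∃[ m ] (P m × ∀ {z} → P z → ¬ z ⊏ m)
  wf⇒minimal wf {w} = acc⇒minimal (wf w)

module TreeProperties {n : ℕ} (T : Tree n) where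
  open Tree T

  ≤-isPartialOrder : IsPartialOrder _≡_ _≤_
  ≤-isPartialOrder = record
    { isPreorder = record
      { isEquivalence = isEquivalence
      ; reflexive     = λ { {x} refl → ≤-refl x }
      ; trans         = ≤-trans
      }
    ; antisym = ≤-antisym
    }

  _<?_ : Decidable _<_
  s <? t = ≤-dec s t ×-dec ¬? (s ≟ t)

  unrelated? : Decidable Unrelated
  unrelated? s t = ¬? (≤-dec s t) ×-dec ¬? (≤-dec t s)

  minimal : {P : Pred (Fin n) 0ℓ} → U.Decidable P →
            ∀ {w} → P w → ∃[ m ] (P m × ∀ {z} → P z → ¬ z < m)
  minimal P? = wf⇒minimal _<?_ P? (po-wellFounded ≤-isPartialOrder)

  maximal : {P : Pred (Fin n) 0ℓ} → U.Decidable P →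
            ∀ {w} → P w → ∃[ m ] (P m × ∀ {z} → P z → ¬ m < z)
  maximal P? = wf⇒minimal (flip _<?_) P? (po-noetherian ≤-isPartialOrder)

  common-lower⇒comparable : ∀ {x a b} → x ≤ a → x ≤ b → a ≤ b ⊎ b ≤ a
  common-lower⇒comparable {x} {a} {b} x≤a x≤b with ≤-dec a b | ≤-dec b a
  ... | yes a≤b | _       = inj₁ a≤b
  ... | no _    | yes b≤a = inj₂ b≤a
  ... | no a≰b  | no b≰a  = ⊥-elim (no-lower a b (a≰b , b≰a) (x , x≤a , x≤b))

  unrelated⇒≢ : ∀ {s t} → Unrelated s t → s ≢ t
  unrelated⇒≢ {s} (s≰t , _) refl = s≰t (≤-refl s)

  unrelated-sym : ∀ {s t} → Unrelated s t → Unrelated t s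
  unrelated-sym (s≰t , t≰s) = t≰s , s≰t

  unrelated-≤ʳ : ∀ {s t t'} → Unrelated s t → t' ≤ t → Unrelated s t'
  unrelated-≤ʳ {s} {t} {t'} (s≰t , t≰s) t'≤t =
    (λ s≤t' → s≰t (≤-trans s≤t' t'≤t)) , (λ t'≤s → no-lower s t (s≰t , t≰s) (t' , t'≤s , t'≤t))

  unrelated-≤ˡ : ∀ {s s' t} → Unrelated s t → s' ≤ s → Unrelated s' t
  unrelated-≤ˡ un s'≤s = unrelated-sym (unrelated-≤ʳ (unrelated-sym un) s'≤s)

  siblings-sym : ∀ {u v} → Siblings u v → Siblings v u
  siblings-sym (un , p , pu , pv) = unrelated-sym un , p , pv , pu

  -- The maximal element of [y, x) is a child of x.
  <⇒child-above : ∀ {x y} → y < x → ∃[ z ] (y ≤ z × Parent x z)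
  <⇒child-above {x} {y} y<x with maximal (λ z → ≤-dec y z ×-dec (z <? x)) (≤-refl y , y<x)
  ... | z , (y≤z , z<x) , max =
    z , y≤z , z<x , λ { (r , z<r , r<x) → max (≤-trans y≤z (proj₁ z<r) , r<x) z<r }

  leaf-minimal : ∀ {x y} → Leaf x → y ≤ x → y ≡ x
  leaf-minimal {x} {y} leaf y≤x with y ≟ x
  ... | yes y≡x = y≡x
  ... | no y≢x  = let (z , _ , x-parent-of-z) = <⇒child-above (y≤x , y≢x) in
                   ⊥-elim (leaf (z , x-parent-of-z))

  leaves-unrelated : ∀ {s t} → Leaf s → Leaf t → s ≢ t → Unrelated s t
  leaves-unrelated ls lt s≢t =
    (λ s≤t → s≢t (leaf-minimal lt s≤t)) , (λ t≤s → s≢t (sym (leaf-minimal ls t≤s)))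

  parent-least : ∀ {p u w} → Parent p u → u < w → p ≤ w
  parent-least {p} {u} {w} (u<p , no-between) u<w
    with common-lower⇒comparable (proj₁ u<p) (proj₁ u<w)
  ... | inj₁ p≤w = p≤w
  ... | inj₂ w≤p with w ≟ p
  ...   | yes refl = ≤-refl p
  ...   | no w≢p   = ⊥-elim (no-between (w , u<w , w≤p , w≢p))

  private
    minimal-below : ∀ u → ∃[ m ] (m ≤ u × ∀ {z} → z ≤ u → ¬ z < m)
    minimal-below u = minimal (λ z → ≤-dec z u) (≤-refl u)

  lowest-leaf : Fin n → Fin n
  lowest-leaf u = proj₁ (minimal-below u)

  lowest-leaf≤ : ∀ u → lowest-leaf u ≤ u
  lowest-leaf≤ u = proj₁ (proj₂ (minimal-below u))

  lowest-leaf-isLeaf : ∀ u → Leaf (lowest-leaf u)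
  lowest-leaf-isLeaf u (z , z<l , _) =
    proj₂ (proj₂ (minimal-below u)) (≤-trans (proj₁ z<l) (lowest-leaf≤ u)) z<l

  -- u and v are children of a minimal common upper bound m of x and y.
  siblings-above : ∀ {x y} → Unrelated x y → ∃[ u ] ∃[ v ] (Siblings u v × x ≤ u × y ≤ v)
  siblings-above {x} {y} x∥y with upper x y x∥y
  ... | w , x≤w , y≤w with minimal (λ z → ≤-dec x z ×-dec ≤-dec y z) (x≤w , y≤w)
  ... | m , (x≤m , y≤m) , min
    with <⇒child-above {m} {x} (x≤m , λ { refl → proj₂ x∥y y≤m })
       | <⇒child-above {m} {y} (y≤m , λ { refl → proj₁ x∥y x≤m })
  ... | u , x≤u , pu | v , y≤v , pv =
    u , v , (u∥v , m , pu , pv) , x≤u , y≤v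
    where
    u∥v : Unrelated u v
    u∥v = (λ u≤v → min (≤-trans x≤u u≤v , y≤v) (proj₁ pv))
        , (λ v≤u → min (x≤u , ≤-trans y≤v v≤u) (proj₁ pu))

  siblings-above-minimal : ∀ {u v u' v' y} → Siblings u v → Siblings u' v' →
                           y ≤ v → y ≤ v' → ¬ u < u'
  siblings-above-minimal {y = y} (_ , p , pu , pv) (u'∥v' , _) y≤v y≤v' u<u' =
    no-lower _ _ u'∥v' (y , ≤-trans y≤v (≤-trans (proj₁ (proj₁ pv)) (parent-least pu u<u')) , y≤v')

  siblings-above-unique : ∀ {u v u' v' x y} → Siblings u v → Siblings u' v' →
                          x ≤ u → y ≤ v → x ≤ u' → y ≤ v' → u ≡ u'
  siblings-above-unique {u} {u' = u'} uv u'v' x≤u y≤v x≤u' y≤v' with u ≟ u'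
  ... | yes u≡u' = u≡u'
  ... | no u≢u' with common-lower⇒comparable x≤u x≤u'
  ...   | inj₁ u≤u' = contradiction (u≤u' , u≢u') (siblings-above-minimal uv u'v' y≤v y≤v')
  ...   | inj₂ u'≤u = contradiction (u'≤u , ≢-sym u≢u') (siblings-above-minimal u'v' uv y≤v' y≤v)

  module FromSiblingColoring {C : Set} (c : Fin n → Fin n → C) (c-sym : IsSColoring c) where

    -- Off the unrelated pairs the value is irrelevant; c s t is a placeholder.
    induced : Fin n → Fin n → C
    induced s t with unrelated? s t
    ... | yes s∥t = let (u , v , _) = siblings-above s∥t in c u v
    ... | no _    = c s t

    induced-spec : ∀ {s t} → Unrelated s t →
                   ∃[ u ] ∃[ v ] (Siblings u v × s ≤ u × t ≤ v × induced s t ≡ c u v)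
    induced-spec {s} {t} s∥t with unrelated? s t
    ... | yes s∥t' = let (u , v , uv , s≤u , t≤v) = siblings-above s∥t' in u , v , uv , s≤u , t≤v , refl
    ... | no ¬s∥t  = contradiction s∥t ¬s∥t

    induced-isInduced : Induced c induced
    induced-isInduced s t ls lt s≢t u' v' u'v' s≤u' t≤v'
      with induced-spec (leaves-unrelated ls lt s≢t)
    ... | u , v , uv , s≤u , t≤v , eq = trans eq (cong₂ c
          (siblings-above-unique uv u'v' s≤u t≤v s≤u' t≤v')
          (siblings-above-unique (siblings-sym uv) (siblings-sym u'v') t≤v s≤u t≤v' s≤u'))

    induced-isKColoring : IsKColoring induced
    induced-isKColoring s t ls lt s≢t with induced-spec (leaves-unrelated ls lt s≢t)
    ... | u , v , uv , s≤u , t≤v , eq = begin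
      induced s t ≡⟨ eq ⟩
      c u v       ≡⟨ c-sym u v uv ⟩
      c v u       ≡⟨ induced-isInduced t s lt ls (≢-sym s≢t) v u (siblings-sym uv) t≤v s≤u ⟨
      induced t s ∎
      where open ≡-Reasoning

    induced⇒property : ∀ κ → Induced c κ → Property κ
    induced⇒property κ κ-ind s r t ls lr lt (a , s<a , r<a , a∥t) with siblings-above a∥t
    ... | u , v , uv , a≤u , t≤v = trans (below-a ls s<a) (sym (below-a lr r<a))
      where
      below-a : ∀ {x} → Leaf x → x < a → κ x t ≡ c u v
      below-a lx (x≤a , _) =
        κ-ind _ t lx lt (unrelated⇒≢ (unrelated-≤ˡ a∥t x≤a)) u v uv (≤-trans x≤a a≤u) t≤v

  module FromLeafColoring {C : Set} (κ : Fin n → Fin n → C)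
                          (κ-sym : IsKColoring κ) (κ-prop : Property κ) where

    atLowestLeaves : Fin n → Fin n → C
    atLowestLeaves u v = κ (lowest-leaf u) (lowest-leaf v)

    -- If s ≠ s' then neither equals u (a leaf has nothing else below it), so u is a common ancestor.
    property⇒leaves-below : ∀ {s s' t u} → Leaf s → Leaf s' → Leaf t →
                            s ≤ u → s' ≤ u → Unrelated u t → κ s t ≡ κ s' t
    property⇒leaves-below {s} {s'} {t} {u} ls ls' lt s≤u s'≤u u∥t with s ≟ s'
    ... | yes refl = refl
    ... | no s≢s'  = κ-prop s s' t ls ls' lt (u , (s≤u , s≢u) , (s'≤u , s'≢u) , u∥t)
      where
      s≢u : s ≢ u
      s≢u refl = s≢s' (sym (leaf-minimal ls s'≤u))
      s'≢u : s' ≢ u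
      s'≢u refl = s≢s' (leaf-minimal ls' s≤u)

    lowest-leaves-unrelated : ∀ {u v} → Unrelated u v → Unrelated (lowest-leaf u) (lowest-leaf v)
    lowest-leaves-unrelated u∥v = unrelated-≤ˡ (unrelated-≤ʳ u∥v (lowest-leaf≤ _)) (lowest-leaf≤ _)

    atLowestLeaves-isSColoring : IsSColoring atLowestLeaves
    atLowestLeaves-isSColoring u v (u∥v , _) =
      κ-sym (lowest-leaf u) (lowest-leaf v) (lowest-leaf-isLeaf u) (lowest-leaf-isLeaf v)
        (unrelated⇒≢ (lowest-leaves-unrelated u∥v))

    atLowestLeaves-isInduced : Induced atLowestLeaves κ
    atLowestLeaves-isInduced s t ls lt s≢t u v (u∥v , _) s≤u t≤v = begin
      κ s t         ≡⟨ property⇒leaves-below ls lu lt s≤u (lowest-leaf≤ u) u∥t ⟩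
      κ (l u) t     ≡⟨ κ-sym (l u) t lu lt (unrelated⇒≢ (unrelated-≤ˡ u∥t (lowest-leaf≤ u))) ⟩
      κ t (l u)     ≡⟨ property⇒leaves-below lt lv lu t≤v (lowest-leaf≤ v) v∥lu ⟩
      κ (l v) (l u) ≡⟨ κ-sym (l u) (l v) lu lv (unrelated⇒≢ (lowest-leaves-unrelated u∥v)) ⟨
      κ (l u) (l v) ∎
      where
      open ≡-Reasoning
      l = lowest-leaf
      lu = lowest-leaf-isLeaf u
      lv = lowest-leaf-isLeaf v
      u∥t : Unrelated u t
      u∥t = unrelated-≤ʳ u∥v t≤v
      v∥lu : Unrelated v (l u)
      v∥lu = unrelated-sym (unrelated-≤ˡ u∥v (lowest-leaf≤ u))

proposition5 : ∀ {n : ℕ} (T : Tree n) (C : Set) →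
    let open Tree T in
    ((c : Fin n → Fin n → C) → IsSColoring c →
      (∃[ κ ] (IsKColoring κ × Induced c κ))
      × (∀ κ → Induced c κ → Property κ))
    × ((κ : Fin n → Fin n → C) → IsKColoring κ → Property κ →
      ∃[ c ] (IsSColoring c × Induced c κ))
proposition5 T C =
    (λ c c-sym → let open TreeProperties.FromSiblingColoring T c c-sym in
       (induced , induced-isKColoring , induced-isInduced) , induced⇒property)
  , (λ κ κ-sym κ-prop → let open TreeProperties.FromLeafColoring T κ κ-sym κ-prop in
       atLowestLeaves , atLowestLeaves-isSColoring , atLowestLeaves-isInduced)
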